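{- Let $i$ be a positive integer and let $G$ be the threshold graph with binary sequence $(0\, 1^{2i+1}0^i 1^{2i+2} 0^{2i+1} 1^{2i})$ (so $G$ has $9i+5$ vertices). Then, to within a sign, the characteristic polynomial of (the adjacency matrix of) $G$ is $$P_G(x) = x^{3i-1} (x+1)^{6i+1} (x+2i+1)\left(x^4 -(8i+2)x^3 -(-8i^2+4i+3)x^2 -(-8i^3 -20i^2-8i)x -8i^4-12i^3-4i^2\right).$$
   Context: A threshold graph on $N$ vertices is coded by a binary sequence $(b_1 b_2 \ldots b_N)$ with $b_1=0$: vertices $v_1,\dots,v_N$ are added in order, and for $j\ge 2$ the vertex $v_j$ is added as an isolated vertex if $b_j=0$ and as a dominating vertex (adjacent to all of $v_1,\dots,v_{j-1}$) if $b_j=1$. Thus for $k<j$, $v_k$ is adjacent to $v_j$ iff $b_j=1$. The notation $(0\,1^{a_2} 0^{a_3} 1^{a_4}\cdots)$ denotes the sequence consisting of one zero, followed by $a_2$ ones, followed by $a_3$ zeros, etc. The characteristic polynomial of a graph is that of its adjacency matrix. -}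

module Defs where

open import Data.Bool using (Bool; true; false; if_then_else_)
open import Data.Nat as ℕ using (ℕ; zero; suc; _<ᵇ_; _≡ᵇ_)
open import Data.Integer using (ℤ; +_; -_; _+_; _*_; 0ℤ; 1ℤ)
open import Data.Fin using (Fin; zero; suc; toℕ; punchIn)
open import Data.List using (List; []; _∷_; map; foldr; allFin)
open import Data.Vec using (Vec; lookup; replicate; _++_) renaming (_∷_ to _∷ᵥ_)
open import Relation.Binary.PropositionalEquality using (_≡_)

-- Polynomials over ℤ as coefficient lists (lowest degree first).

Poly : Set
Poly = List ℤ

infixl 6 _+P_ _-P_
infixl 7 _*P_
infixr 8 _^P_

_+P_ : Poly → Poly → Poly
[] +P q = q
(a ∷ p) +P [] = a ∷ p
(a ∷ p) +P (b ∷ q) = (a + b) ∷ (p +P q)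

scaleP : ℤ → Poly → Poly
scaleP a p = map (a *_) p

negP : Poly → Poly
negP p = scaleP (- 1ℤ) p

_-P_ : Poly → Poly → Poly
p -P q = p +P negP q

_*P_ : Poly → Poly → Poly
[] *P q = []
(a ∷ p) *P q = scaleP a q +P (0ℤ ∷ (p *P q))

constP : ℤ → Poly
constP a = a ∷ []

X : Poly
X = 0ℤ ∷ 1ℤ ∷ []

_^P_ : Poly → ℕ → Poly
p ^P zero = constP 1ℤ
p ^P suc n = p *P (p ^P n)

coeff : Poly → ℕ → ℤ
coeff [] n = 0ℤ
coeff (a ∷ p) zero = a
coeff (a ∷ p) (suc n) = coeff p n

_≈P_ : Poly → Poly → Set
p ≈P q = ∀ n → coeff p n ≡ coeff q n

sumP : List Poly → Poly
sumP = foldr _+P_ []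

signP : ℕ → Poly → Poly
signP zero p = p
signP (suc k) p = negP (signP k p)

det : ∀ n → (Fin n → Fin n → Poly) → Poly
det zero M = constP 1ℤ
det (suc n) M =
  sumP (map (λ j → signP (toℕ j)
                     (M zero j *P det n (λ r c → M (suc r) (punchIn j c))))
            (allFin (suc n)))

charPoly : ∀ n → (Fin n → Fin n → ℤ) → Poly
charPoly n A = det n (λ r c → (if toℕ r ≡ᵇ toℕ c then X else []) -P constP (A r c))

-- Threshold graphs from binary sequences.
-- For k < j, v_k ~ v_j iff b_j = 1 (true); no loops.

thresholdAdj : ∀ {N} → Vec Bool N → Fin N → Fin N → Bool
thresholdAdj b k j =
  if toℕ k <ᵇ toℕ j then lookup b j
  else if toℕ j <ᵇ toℕ k then lookup b k
  else false

boolℤ : Bool → ℤ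
boolℤ true = 1ℤ
boolℤ false = 0ℤ

adjMatrix : ∀ {N} → Vec Bool N → Fin N → Fin N → ℤ
adjMatrix b k j = boolℤ (thresholdAdj b k j)

charPolyThreshold : ∀ {N} → Vec Bool N → Poly
charPolyThreshold {N} b = charPoly N (adjMatrix b)

seqG : (i : ℕ) → Vec Bool _
seqG i = false ∷ᵥ (replicate (suc (2 ℕ.* i)) true
                ++ (replicate i false
                ++ (replicate (2 ℕ.* i ℕ.+ 2) true
                ++ (replicate (suc (2 ℕ.* i)) false
                ++ replicate (2 ℕ.* i) true))))

-- Write χ(b) for the characteristic polynomial of the threshold graph coded by b.  In the
-- characteristic matrix of y β w the rows of the first two vertices agree outside the first two
-- columns, so subtracting them and expanding along the first row gives
--   χ(y β w) = c (2 χ(β w) − c χ(w)),  where c = x + β,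
-- and in particular χ(y w) does not depend on y.  So prepending a bit β acts on the pair
-- (χ(y w), χ(w)) by a 2 × 2 matrix with the double eigenvalue c, and a run of m + 1 equal bits acts
-- by c^m times a matrix whose entries are linear in m.  Composing the five runs of the sequence,
-- starting from (χ(0), χ()) = (x, 1), turns the claimed factorisation into a polynomial identity
-- in x, i and the powers of x and x + 1 produced by the runs, which the ring solver checks.

module Submission where

open import Defs
open import Data.Nat using (ℕ; _≤_)
open import Data.Integer using (ℤ; +_; -_; _+_; _*_; _-_)
open import Data.Sum using (_⊎_)

open import Algebra.Bundles using (CommutativeRing)
open import Algebra.Bundles.Raw using (RawRing)
import Algebra.Solver.Ring
open import Algebra.Solver.Ring.AlmostCommutativeRing using (fromCommutativeRing; _-Raw-AlmostCommutative⟶_)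
open import Data.Bool using (Bool; false; true; if_then_else_)
open import Data.Fin using (Fin; zero; suc; toℕ; punchIn; lift)
open import Data.Integer using (_^_; 0ℤ; 1ℤ)
import Data.Integer.Properties as ℤ
open import Algebra.Properties.CommutativeSemigroup ℤ.+-commutativeSemigroup using (interchange; x∙yz≈y∙xz)
open import Data.List using ([]; _∷_; tabulate)
import Data.List.Properties as List
open import Data.Maybe using (Maybe; just; nothing)
open import Data.Nat as ℕ using (zero; suc; _≡ᵇ_)
import Data.Nat.Properties
open import Data.Nat.Tactic.RingSolver using (solve-∀)
open import Data.Product using (_×_; _,_; proj₁; proj₂)
open import Data.Product.Relation.Binary.Pointwise.NonDependent using (×-setoid)
open import Data.Sum using (inj₁)
open import Data.Unit using (⊤; tt)
open import Data.Vec using (Vec; []; lookup; map; replicate; _++_; tail) renaming (_∷_ to _∷ᵥ_)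
open import Data.Vec.Functional using (Vector)
open import Data.Vec.Properties using (lookup-map)
open import Function using (_∘_; id)
open import Relation.Binary.Bundles using (Setoid)
open import Relation.Binary.PropositionalEquality
  using (_≡_; _≗_; refl; sym; trans; cong; cong₂; module ≡-Reasoning)
open import Relation.Nullary using (yes; no)

-- Polynomials over ℤ form a commutative ring

coeff-+P : ∀ p q n → coeff (p +P q) n ≡ coeff p n + coeff q n
coeff-+P []      q       n       = sym (ℤ.+-identityˡ _)
coeff-+P (a ∷ p) []      n       = sym (ℤ.+-identityʳ _)
coeff-+P (a ∷ p) (b ∷ q) zero    = refl
coeff-+P (a ∷ p) (b ∷ q) (suc n) = coeff-+P p q n

coeff-scaleP : ∀ a p n → coeff (scaleP a p) n ≡ a * coeff p n
coeff-scaleP a []      n       = sym (ℤ.*-zeroʳ a)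
coeff-scaleP a (b ∷ p) zero    = refl
coeff-scaleP a (b ∷ p) (suc n) = coeff-scaleP a p n

coeff-negP : ∀ p n → coeff (negP p) n ≡ - coeff p n
coeff-negP p n = trans (coeff-scaleP (- 1ℤ) p n) (ℤ.-1*i≡-i (coeff p n))

convolution : (ℕ → ℤ) → (ℕ → ℤ) → ℕ → ℤ
convolution f g zero    = f 0 * g 0
convolution f g (suc n) = f 0 * g (suc n) + convolution (λ k → f (suc k)) g n

convolution-zeroˡ : ∀ g n → convolution (λ _ → 0ℤ) g n ≡ 0ℤ
convolution-zeroˡ g zero    = refl
convolution-zeroˡ g (suc n) = trans (ℤ.+-identityˡ _) (convolution-zeroˡ g n)

convolution-cong : ∀ {f f′ g g′} → (∀ n → f n ≡ f′ n) → (∀ n → g n ≡ g′ n) →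
                   ∀ n → convolution f g n ≡ convolution f′ g′ n
convolution-cong f≡ g≡ zero    = cong₂ _*_ (f≡ 0) (g≡ 0)
convolution-cong f≡ g≡ (suc n) =
  cong₂ _+_ (cong₂ _*_ (f≡ 0) (g≡ (suc n))) (convolution-cong (λ k → f≡ (suc k)) g≡ n)

convolution-distribʳ : ∀ f g h n →
  convolution (λ k → f k + g k) h n ≡ convolution f h n + convolution g h n
convolution-distribʳ f g h zero    = ℤ.*-distribʳ-+ (h 0) (f 0) (g 0)
convolution-distribʳ f g h (suc n) = begin
  (f 0 + g 0) * h (suc n) + convolution (λ k → f (suc k) + g (suc k)) h n
    ≡⟨ cong₂ _+_ (ℤ.*-distribʳ-+ (h (suc n)) (f 0) (g 0))
                 (convolution-distribʳ (λ k → f (suc k)) (λ k → g (suc k)) h n) ⟩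
  (f 0 * h (suc n) + g 0 * h (suc n)) + (convolution (λ k → f (suc k)) h n + convolution (λ k → g (suc k)) h n)
    ≡⟨ interchange (f 0 * h (suc n)) (g 0 * h (suc n)) _ _ ⟩
  (f 0 * h (suc n) + convolution (λ k → f (suc k)) h n) + (g 0 * h (suc n) + convolution (λ k → g (suc k)) h n) ∎
  where open ≡-Reasoning

convolution-scaleˡ : ∀ a f g n → convolution (λ k → a * f k) g n ≡ a * convolution f g n
convolution-scaleˡ a f g zero    = ℤ.*-assoc a (f 0) (g 0)
convolution-scaleˡ a f g (suc n) =
  trans (cong₂ _+_ (ℤ.*-assoc a (f 0) (g (suc n))) (convolution-scaleˡ a (λ k → f (suc k)) g n))
        (sym (ℤ.*-distribˡ-+ a _ _))

coeff-*P : ∀ p q n → coeff (p *P q) n ≡ convolution (coeff p) (coeff q) n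
coeff-*P []      q n       = sym (convolution-zeroˡ (coeff q) n)
coeff-*P (a ∷ p) q zero    =
  trans (coeff-+P (scaleP a q) (0ℤ ∷ (p *P q)) 0) (trans (ℤ.+-identityʳ _) (coeff-scaleP a q 0))
coeff-*P (a ∷ p) q (suc n) =
  trans (coeff-+P (scaleP a q) (0ℤ ∷ (p *P q)) (suc n)) (cong₂ _+_ (coeff-scaleP a q (suc n)) (coeff-*P p q n))

-- ≈P wrapped in a record, so that its two sides can be inferred.
infix 4 _≈_
record _≈_ (p q : Poly) : Set where
  constructor coeffwise
  field coeff-≡ : p ≈P q
open _≈_ public

≈-refl : ∀ {p} → p ≈ p
≈-refl = coeffwise λ _ → refl

≈-sym : ∀ {p q} → p ≈ q → q ≈ p
≈-sym (coeffwise e) = coeffwise λ n → sym (e n)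

≈-trans : ∀ {p q r} → p ≈ q → q ≈ r → p ≈ r
≈-trans (coeffwise e) (coeffwise f) = coeffwise λ n → trans (e n) (f n)

≡⇒≈ : ∀ {p q} → p ≡ q → p ≈ q
≡⇒≈ refl = ≈-refl

∷-cong : ∀ {a b p q} → a ≡ b → p ≈ q → a ∷ p ≈ b ∷ q
∷-cong a≡b (coeffwise e) = coeffwise λ { zero → a≡b ; (suc n) → e n }

+P-cong : ∀ {p p′ q q′} → p ≈ p′ → q ≈ q′ → p +P q ≈ p′ +P q′
+P-cong {p} {p′} {q} {q′} (coeffwise e) (coeffwise f) = coeffwise λ n →
  trans (coeff-+P p q n) (trans (cong₂ _+_ (e n) (f n)) (sym (coeff-+P p′ q′ n)))

*P-cong : ∀ {p p′ q q′} → p ≈ p′ → q ≈ q′ → p *P q ≈ p′ *P q′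
*P-cong {p} {p′} {q} {q′} (coeffwise e) (coeffwise f) = coeffwise λ n →
  trans (coeff-*P p q n) (trans (convolution-cong e f n) (sym (coeff-*P p′ q′ n)))

negP-cong : ∀ {p q} → p ≈ q → negP p ≈ negP q
negP-cong {p} {q} (coeffwise e) = coeffwise λ n →
  trans (coeff-negP p n) (trans (cong -_ (e n)) (sym (coeff-negP q n)))

+P-assoc : ∀ p q r → (p +P q) +P r ≈ p +P (q +P r)
+P-assoc p q r = coeffwise λ n → begin
  coeff ((p +P q) +P r) n           ≡⟨ coeff-+P (p +P q) r n ⟩
  coeff (p +P q) n + coeff r n      ≡⟨ cong (_+ coeff r n) (coeff-+P p q n) ⟩
  coeff p n + coeff q n + coeff r n ≡⟨ ℤ.+-assoc (coeff p n) _ _ ⟩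
  coeff p n + (coeff q n + coeff r n) ≡⟨ cong (λ z → coeff p n + z) (sym (coeff-+P q r n)) ⟩
  coeff p n + coeff (q +P r) n      ≡⟨ sym (coeff-+P p (q +P r) n) ⟩
  coeff (p +P (q +P r)) n           ∎
  where open ≡-Reasoning

+P-comm : ∀ p q → p +P q ≈ q +P p
+P-comm p q = coeffwise λ n →
  trans (coeff-+P p q n) (trans (ℤ.+-comm (coeff p n) _) (sym (coeff-+P q p n)))

+P-identityʳ : ∀ p → p +P [] ≈ p
+P-identityʳ p = coeffwise λ n → trans (coeff-+P p [] n) (ℤ.+-identityʳ _)

+P-inverseˡ : ∀ p → negP p +P p ≈ []
+P-inverseˡ p = coeffwise λ n →
  trans (coeff-+P (negP p) p n) (trans (cong (_+ coeff p n) (coeff-negP p n)) (ℤ.+-inverseˡ (coeff p n)))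

*P-distribʳ : ∀ r p q → (p +P q) *P r ≈ p *P r +P q *P r
*P-distribʳ r p q = coeffwise λ n → begin
  coeff ((p +P q) *P r) n
    ≡⟨ coeff-*P (p +P q) r n ⟩
  convolution (coeff (p +P q)) (coeff r) n
    ≡⟨ convolution-cong (coeff-+P p q) (λ _ → refl) n ⟩
  convolution (λ k → coeff p k + coeff q k) (coeff r) n
    ≡⟨ convolution-distribʳ (coeff p) (coeff q) (coeff r) n ⟩
  convolution (coeff p) (coeff r) n + convolution (coeff q) (coeff r) n
    ≡⟨ sym (cong₂ _+_ (coeff-*P p r n) (coeff-*P q r n)) ⟩
  coeff (p *P r) n + coeff (q *P r) n
    ≡⟨ sym (coeff-+P (p *P r) (q *P r) n) ⟩
  coeff (p *P r +P q *P r) n ∎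
  where open ≡-Reasoning

scaleP-*P : ∀ a p q → scaleP a p *P q ≈ scaleP a (p *P q)
scaleP-*P a p q = coeffwise λ n → begin
  coeff (scaleP a p *P q) n                   ≡⟨ coeff-*P (scaleP a p) q n ⟩
  convolution (coeff (scaleP a p)) (coeff q) n ≡⟨ convolution-cong (coeff-scaleP a p) (λ _ → refl) n ⟩
  convolution (λ k → a * coeff p k) (coeff q) n ≡⟨ convolution-scaleˡ a (coeff p) (coeff q) n ⟩
  a * convolution (coeff p) (coeff q) n        ≡⟨ cong (λ z → a * z) (sym (coeff-*P p q n)) ⟩
  a * coeff (p *P q) n                         ≡⟨ sym (coeff-scaleP a (p *P q) n) ⟩
  coeff (scaleP a (p *P q)) n                  ∎
  where open ≡-Reasoning

shift-*P : ∀ p q → (0ℤ ∷ p) *P q ≈ 0ℤ ∷ (p *P q)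
shift-*P p q = coeffwise λ n →
  trans (coeff-+P (scaleP 0ℤ q) (0ℤ ∷ (p *P q)) n)
        (trans (cong (_+ coeff (0ℤ ∷ (p *P q)) n) (coeff-scaleP 0ℤ q n)) (ℤ.+-identityˡ _))

*P-assoc : ∀ p q r → (p *P q) *P r ≈ p *P (q *P r)
*P-assoc []      q r = ≈-refl
*P-assoc (a ∷ p) q r = ≈-trans (*P-distribʳ r (scaleP a q) (0ℤ ∷ (p *P q)))
  (+P-cong (scaleP-*P a q r) (≈-trans (shift-*P (p *P q) r) (∷-cong refl (*P-assoc p q r))))

*P-zeroʳ : ∀ p → p *P [] ≈ []
*P-zeroʳ []      = ≈-refl
*P-zeroʳ (a ∷ p) = coeffwise λ { zero → refl ; (suc n) → coeff-≡ (*P-zeroʳ p) n }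

*P-∷ʳ : ∀ p a q → p *P (a ∷ q) ≈ scaleP a p +P (0ℤ ∷ (p *P q))
*P-∷ʳ []      a q = coeffwise λ { zero → refl ; (suc n) → refl }
*P-∷ʳ (b ∷ p) a q = coeffwise λ
  { zero    → cong (_+ 0ℤ) (ℤ.*-comm b a)
  ; (suc n) → begin
      coeff (scaleP b q +P (p *P (a ∷ q))) n
        ≡⟨ coeff-+P (scaleP b q) _ n ⟩
      coeff (scaleP b q) n + coeff (p *P (a ∷ q)) n
        ≡⟨ cong (λ z → coeff (scaleP b q) n + z) (trans (coeff-≡ (*P-∷ʳ p a q) n) (coeff-+P (scaleP a p) _ n)) ⟩
      coeff (scaleP b q) n + (coeff (scaleP a p) n + coeff (0ℤ ∷ (p *P q)) n)
        ≡⟨ x∙yz≈y∙xz (coeff (scaleP b q) n) (coeff (scaleP a p) n) _ ⟩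
      coeff (scaleP a p) n + (coeff (scaleP b q) n + coeff (0ℤ ∷ (p *P q)) n)
        ≡⟨ cong (λ z → coeff (scaleP a p) n + z) (sym (coeff-+P (scaleP b q) _ n)) ⟩
      coeff (scaleP a p) n + coeff (scaleP b q +P (0ℤ ∷ (p *P q))) n
        ≡⟨ sym (coeff-+P (scaleP a p) _ n) ⟩
      coeff (scaleP a p +P (scaleP b q +P (0ℤ ∷ (p *P q)))) n ∎ }
  where open ≡-Reasoning

*P-comm : ∀ p q → p *P q ≈ q *P p
*P-comm []      q = ≈-sym (*P-zeroʳ q)
*P-comm (a ∷ p) q = ≈-trans (+P-cong (≈-refl {scaleP a q}) (∷-cong refl (*P-comm p q))) (≈-sym (*P-∷ʳ q a p))

*P-identityˡ : ∀ p → constP 1ℤ *P p ≈ p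
*P-identityˡ p = coeffwise λ n →
  trans (coeff-+P (scaleP 1ℤ p) (0ℤ ∷ []) n)
        (trans (cong₂ _+_ (coeff-scaleP 1ℤ p n) (coeff-zero n)) (trans (ℤ.+-identityʳ _) (ℤ.*-identityˡ _)))
  where
  coeff-zero : ∀ n → coeff (0ℤ ∷ []) n ≡ 0ℤ
  coeff-zero zero    = refl
  coeff-zero (suc n) = refl

ℤ[X] : CommutativeRing _ _
ℤ[X] = record
  { Carrier = Poly
  ; _≈_ = _≈_
  ; _+_ = _+P_
  ; _*_ = _*P_
  ; -_ = negP
  ; 0# = []
  ; 1# = constP 1ℤ
  ; isCommutativeRing = record
    { isRing = record
      { +-isAbelianGroup = record
        { isGroup = record
          { isMonoid = record
            { isSemigroup = record
              { isMagma = record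
                { isEquivalence = record { refl = ≈-refl ; sym = ≈-sym ; trans = ≈-trans }
                ; ∙-cong = +P-cong }
              ; assoc = +P-assoc }
            ; identity = (λ p → ≈-refl) , +P-identityʳ }
          ; inverse = +P-inverseˡ , (λ p → ≈-trans (+P-comm p (negP p)) (+P-inverseˡ p))
          ; ⁻¹-cong = negP-cong }
        ; comm = +P-comm }
      ; *-cong = *P-cong
      ; *-assoc = *P-assoc
      ; *-identity = *P-identityˡ , (λ p → ≈-trans (*P-comm p _) (*P-identityˡ p))
      ; distrib = (λ r p q → ≈-trans (*P-comm r _) (≈-trans (*P-distribʳ r p q)
                                       (+P-cong (*P-comm p r) (*P-comm q r))))
                , *P-distribʳ }
    ; *-comm = *P-comm }
  }

constP-homomorphism :
  CommutativeRing.rawRing ℤ.+-*-commutativeRing -Raw-AlmostCommutative⟶ fromCommutativeRing ℤ[X]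
constP-homomorphism = record
  { ⟦_⟧    = constP
  ; +-homo = λ a b → ≈-refl
  ; *-homo = λ a b → ∷-cong (sym (ℤ.+-identityʳ _)) ≈-refl
  ; -‿homo = λ a → ∷-cong (sym (ℤ.-1*i≡-i a)) ≈-refl
  ; 0-homo = coeffwise λ { zero → refl ; (suc n) → refl }
  ; 1-homo = ≈-refl
  }

constP-≟ : ∀ a b → Maybe (constP a ≈ constP b)
constP-≟ a b with a ℤ.≟ b
... | yes refl = just ≈-refl
... | no _     = nothing

module ℤ[X]-Solver = Algebra.Solver.Ring _ _ constP-homomorphism constP-≟

open CommutativeRing ℤ[X]
  using (setoid; +-cong; +-congˡ; +-congʳ; *-cong; *-congˡ; *-congʳ; -‿cong; +-identityʳ; -‿inverseʳ)
open import Algebra.Properties.Semiring.Sum (CommutativeRing.semiring ℤ[X])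
  using (sum; sum-cong-≋; ∑-distrib-+; *-distribˡ-sum; sum-replicate-zero)
open import Relation.Binary.Reasoning.Setoid setoid
open ℤ[X]-Solver using (Polynomial; op; [+]; [*]; con; var; _:^_; :-_; ⟦_⟧; solve; _:=_; _:+_; _:-_; _:*_)
open _-Raw-AlmostCommutative⟶_ constP-homomorphism using (*-homo; -‿homo)

^P-+ : ∀ p m n → p ^P (m ℕ.+ n) ≈ p ^P m *P p ^P n
^P-+ p zero    n = ≈-sym (*P-identityˡ _)
^P-+ p (suc m) n = ≈-trans (*-congˡ {p} (^P-+ p m n)) (≈-sym (*P-assoc p _ _))

⟦_⟧ℤ : ∀ {n} → Polynomial n → Vec ℤ n → ℤ
⟦ op [+] p q ⟧ℤ ρ = ⟦ p ⟧ℤ ρ + ⟦ q ⟧ℤ ρ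
⟦ op [*] p q ⟧ℤ ρ = ⟦ p ⟧ℤ ρ * ⟦ q ⟧ℤ ρ
⟦ con c ⟧ℤ      ρ = c
⟦ var x ⟧ℤ      ρ = lookup ρ x
⟦ p :^ n ⟧ℤ     ρ = ⟦ p ⟧ℤ ρ ^ n
⟦ :- p ⟧ℤ       ρ = - ⟦ p ⟧ℤ ρ

constP-⟦⟧ : ∀ {n} (e : Polynomial n) ρ → constP (⟦ e ⟧ℤ ρ) ≈ ⟦ e ⟧ (map constP ρ)
constP-⟦⟧ (op [+] p q) ρ = +-cong (constP-⟦⟧ p ρ) (constP-⟦⟧ q ρ)
constP-⟦⟧ (op [*] p q) ρ = ≈-trans (*-homo (⟦ p ⟧ℤ ρ) _) (*-cong (constP-⟦⟧ p ρ) (constP-⟦⟧ q ρ))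
constP-⟦⟧ (con c)      ρ = ≈-refl
constP-⟦⟧ (var x)      ρ = ≡⇒≈ (sym (lookup-map x constP ρ))
constP-⟦⟧ (p :^ n)     ρ = power n
  where
  power : ∀ n → constP (⟦ p ⟧ℤ ρ ^ n) ≈ ⟦ p :^ n ⟧ (map constP ρ)
  power zero    = ≈-refl
  power (suc n) = ≈-trans (*-homo (⟦ p ⟧ℤ ρ) _) (*-cong (constP-⟦⟧ p ρ) (power n))
constP-⟦⟧ (:- p)       ρ = ≈-trans (-‿homo (⟦ p ⟧ℤ ρ)) (-‿cong (constP-⟦⟧ p ρ))

-- Laplace expansion along the first row

Matrix : ℕ → Set
Matrix n = Fin n → Fin n → Poly

minor : ∀ {n} → Fin (suc n) → Matrix (suc n) → Matrix n
minor j M r c = M (suc r) (punchIn j c)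

laplace₀ : ∀ {n} → Vector Poly (suc n) → Matrix (suc n) → Poly
laplace₀ {n} u M = sum λ j → signP (toℕ j) (u j *P det n (minor j M))

sumP-tabulate : ∀ {n} (f : Vector Poly n) → sumP (tabulate f) ≡ sum f
sumP-tabulate {zero}  f = refl
sumP-tabulate {suc n} f = cong (f zero +P_) (sumP-tabulate (f ∘ suc))

det-laplace₀ : ∀ n M → det (suc n) M ≡ laplace₀ (M zero) M
det-laplace₀ n M = trans (cong sumP (List.map-tabulate id expansion)) (sumP-tabulate expansion)
  where
  expansion : Vector Poly (suc n)
  expansion j = signP (toℕ j) (M zero j *P det n (minor j M))

signP-cong : ∀ k {p q} → p ≈ q → signP k p ≈ signP k q
signP-cong zero    p≈q = p≈q
signP-cong (suc k) p≈q = -‿cong (signP-cong k p≈q)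

signP-*ˡ : ∀ k a p → a *P signP k p ≈ signP k (a *P p)
signP-*ˡ zero    a p = ≈-refl
signP-*ˡ (suc k) a p = begin
  a *P negP (signP k p) ≈⟨ solve 2 (λ a s → a :* (:- s) := :- (a :* s)) ≈-refl a (signP k p) ⟩
  negP (a *P signP k p) ≈⟨ -‿cong (signP-*ˡ k a p) ⟩
  negP (signP k (a *P p)) ∎

signP-+P : ∀ k p q → signP k (p +P q) ≈ signP k p +P signP k q
signP-+P zero    p q = ≈-refl
signP-+P (suc k) p q = begin
  negP (signP k (p +P q))              ≈⟨ -‿cong (signP-+P k p q) ⟩
  negP (signP k p +P signP k q)        ≈⟨ solve 2 (λ a b → :- (a :+ b) := :- a :+ :- b) ≈-refl (signP k p) _ ⟩
  negP (signP k p) +P negP (signP k q) ∎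

signP-negP : ∀ k p → signP k (negP p) ≈ negP (signP k p)
signP-negP zero    p = ≈-refl
signP-negP (suc k) p = -‿cong (signP-negP k p)

det-cong : ∀ n {M M′ : Matrix n} → (∀ r c → M r c ≈ M′ r c) → det n M ≈ det n M′
det-cong zero    M≈M′ = ≈-refl
det-cong (suc n) {M} {M′} M≈M′ rewrite det-laplace₀ n M | det-laplace₀ n M′ =
  sum-cong-≋ λ j → signP-cong (toℕ j)
    (*-cong (M≈M′ zero j) (det-cong n λ r c → M≈M′ (suc r) (punchIn j c)))

laplace₀-cong : ∀ {n} (u : Vector Poly (suc n)) (M M′ : Matrix (suc n)) →
  (∀ r c → M (suc r) c ≈ M′ (suc r) c) → laplace₀ u M ≈ laplace₀ u M′
laplace₀-cong {n} u M M′ M≈M′ = sum-cong-≋ λ j → signP-cong (toℕ j)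
  (*-congˡ {u j} (det-cong n λ r c → M≈M′ r (punchIn j c)))

sum-negP : ∀ {n} (f : Vector Poly n) → sum (λ i → negP (f i)) ≈ negP (sum f)
sum-negP {zero}  f = coeffwise λ _ → refl
sum-negP {suc n} f = begin
  negP (f zero) +P sum (λ i → negP (f (suc i))) ≈⟨ +-congˡ (sum-negP (f ∘ suc)) ⟩
  negP (f zero) +P negP (sum (f ∘ suc))         ≈⟨ solve 2 (λ a b → :- a :+ :- b := :- (a :+ b)) ≈-refl (f zero) _ ⟩
  negP (f zero +P sum (f ∘ suc))                ∎

-- t j k is the term of a double Laplace expansion that uses columns j and punchIn j k;
-- PairSymmetric says that it depends only on that unordered pair of columns.
PairSymmetric : ∀ m → (Fin (suc m) → Fin m → Poly) → Set
PairSymmetric zero    t = ⊤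
PairSymmetric (suc m) t =
  (∀ k → t zero k ≈ t (suc k) zero) × PairSymmetric m (λ j k → t (suc j) (suc k))

PairSymmetric-cong : ∀ m {t t′} → (∀ j k → t j k ≈ t′ j k) → PairSymmetric m t → PairSymmetric m t′
PairSymmetric-cong zero    t≈t′ tt         = tt
PairSymmetric-cong (suc m) t≈t′ (t₀ , t₊) =
  (λ k → ≈-trans (≈-sym (t≈t′ zero k)) (≈-trans (t₀ k) (t≈t′ (suc k) zero))) ,
  PairSymmetric-cong m (λ j k → t≈t′ (suc j) (suc k)) t₊

alternatingSum : ∀ m → (Fin (suc m) → Fin m → Poly) → Poly
alternatingSum m t = sum λ j → signP (toℕ j) (sum λ k → signP (toℕ k) (t j k))

-- The terms using columns 0 and k+1 appear once for j = 0 and once for j = k+1, with opposite signs.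
alternatingSum-pairSymmetric : ∀ m t → PairSymmetric m t → alternatingSum m t ≈ []
alternatingSum-pairSymmetric zero    t _          = ≈-refl
alternatingSum-pairSymmetric (suc m) t (t₀ , t₊) = begin
  A +P sum (λ j → signP (suc (toℕ j)) (t (suc j) zero +P sum λ k → negP (signP (toℕ k) (t (suc j) (suc k)))))
    ≈⟨ +-congˡ {A} (sum-cong-≋ λ j → split (toℕ j) (t (suc j) zero) (λ k → signP (toℕ k) (t (suc j) (suc k)))) ⟩
  A +P sum (λ j → negP (b j) +P signP (toℕ j) (inner j))
    ≈⟨ +-congˡ {A} (∑-distrib-+ (λ j → negP (b j)) (λ j → signP (toℕ j) (inner j))) ⟩
  A +P (sum (λ j → negP (b j)) +P alternatingSum m (λ j k → t (suc j) (suc k)))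
    ≈⟨ +-congˡ {A} (+-cong (sum-negP b) (alternatingSum-pairSymmetric m _ t₊)) ⟩
  A +P (negP (sum b) +P [])
    ≈⟨ +-congʳ (sum-cong-≋ λ k → signP-cong (toℕ k) (t₀ k)) ⟩
  sum b +P (negP (sum b) +P [])
    ≈⟨ +-congˡ {sum b} (+-identityʳ (negP (sum b))) ⟩
  sum b +P negP (sum b)
    ≈⟨ -‿inverseʳ (sum b) ⟩
  [] ∎
  where
  A : Poly
  A = sum λ k → signP (toℕ k) (t zero k)
  b : Vector Poly (suc m)
  b j = signP (toℕ j) (t (suc j) zero)
  inner : Fin (suc m) → Poly
  inner j = sum λ k → signP (toℕ k) (t (suc j) (suc k))
  split : ∀ i a (f : Vector Poly m) →
    signP (suc i) (a +P sum (λ k → negP (f k))) ≈ negP (signP i a) +P signP i (sum f)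
  split i a f = begin
    negP (signP i (a +P sum (λ k → negP (f k))))
      ≈⟨ -‿cong (signP-cong i (+-congˡ (sum-negP f))) ⟩
    negP (signP i (a +P negP (sum f)))
      ≈⟨ -‿cong (signP-+P i a (negP (sum f))) ⟩
    negP (signP i a +P signP i (negP (sum f)))
      ≈⟨ -‿cong (+-congˡ (signP-negP i (sum f))) ⟩
    negP (signP i a +P negP (signP i (sum f)))
      ≈⟨ solve 2 (λ a s → :- (a :+ :- s) := :- a :+ s) ≈-refl (signP i a) _ ⟩
    negP (signP i a) +P signP i (sum f) ∎

lift-punchIn : ∀ {n} (j : Fin (suc (suc n))) (k : Fin (suc n)) →
  lift 1 (punchIn j ∘ punchIn k) ≗ punchIn (suc j) ∘ punchIn (suc k)
lift-punchIn j k zero    = refl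
lift-punchIn j k (suc c) = refl

pairSymmetric-punchIn : ∀ n (F : Fin (suc (suc n)) → Fin (suc (suc n)) → (Fin n → Fin (suc (suc n))) → Poly) →
  (∀ a b σ → F a b σ ≈ F b a σ) → (∀ a b {σ τ} → σ ≗ τ → F a b σ ≈ F a b τ) →
  PairSymmetric (suc n) (λ j k → F j (punchIn j k) (punchIn j ∘ punchIn k))
pairSymmetric-punchIn zero    F F-sym F-resp = (λ k → F-sym zero (suc k) (suc ∘ punchIn k)) , tt
pairSymmetric-punchIn (suc n) F F-sym F-resp =
  (λ k → F-sym zero (suc k) (suc ∘ punchIn k)) ,
  PairSymmetric-cong (suc n) (λ j k → F-resp (suc j) (suc (punchIn j k)) (lift-punchIn j k))
    (pairSymmetric-punchIn n (λ a b σ → F (suc a) (suc b) (lift 1 σ))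
      (λ a b σ → F-sym (suc a) (suc b) (lift 1 σ))
      (λ a b σ≗τ → F-resp (suc a) (suc b) λ { zero → refl ; (suc c) → cong suc (σ≗τ c) }))

det-equal-rows₀₁ : ∀ n (M : Matrix (suc (suc n))) → (∀ c → M zero c ≈ M (suc zero) c) → det (suc (suc n)) M ≈ []
det-equal-rows₀₁ n M row₀≈row₁ = begin
  det (suc (suc n)) M
    ≡⟨ det-laplace₀ (suc n) M ⟩
  laplace₀ (M zero) M
    ≈⟨ sum-cong-≋ (λ j → signP-cong (toℕ j) (expand-minor j)) ⟩
  alternatingSum (suc n) (λ j k → F j (punchIn j k) (punchIn j ∘ punchIn k))
    ≈⟨ alternatingSum-pairSymmetric (suc n) (λ j k → F j (punchIn j k) (punchIn j ∘ punchIn k))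
                                  (pairSymmetric-punchIn n F F-sym F-resp) ⟩
  [] ∎
  where
  G : (Fin n → Fin (suc (suc n))) → Poly
  G σ = det n λ r c → M (suc (suc r)) (σ c)
  F : Fin (suc (suc n)) → Fin (suc (suc n)) → (Fin n → Fin (suc (suc n))) → Poly
  F a b σ = M zero a *P (M zero b *P G σ)
  F-sym : ∀ a b σ → F a b σ ≈ F b a σ
  F-sym a b σ = solve 3 (λ x y z → x :* (y :* z) := y :* (x :* z)) ≈-refl (M zero a) (M zero b) (G σ)
  F-resp : ∀ a b {σ τ} → σ ≗ τ → F a b σ ≈ F a b τ
  F-resp a b σ≗τ =
    *-congˡ {M zero a} (*-congˡ {M zero b} (det-cong n λ r c → ≡⇒≈ (cong (M (suc (suc r))) (σ≗τ c))))
  expand-minor : ∀ j →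
    M zero j *P det (suc n) (minor j M) ≈ sum λ k → signP (toℕ k) (F j (punchIn j k) (punchIn j ∘ punchIn k))
  expand-minor j = begin
    M zero j *P det (suc n) (minor j M)
      ≡⟨ cong (M zero j *P_) (det-laplace₀ n (minor j M)) ⟩
    M zero j *P laplace₀ (M (suc zero) ∘ punchIn j) (minor j M)
      ≈⟨ *-distribˡ-sum (M zero j) (λ k → signP (toℕ k) (M (suc zero) (punchIn j k) *P G (punchIn j ∘ punchIn k))) ⟩
    sum (λ k → M zero j *P signP (toℕ k) (M (suc zero) (punchIn j k) *P G (punchIn j ∘ punchIn k)))
      ≈⟨ sum-cong-≋ (λ k → ≈-trans (signP-*ˡ (toℕ k) (M zero j) _)
                            (signP-cong (toℕ k) (*-congˡ {M zero j} (*-congʳ {G (punchIn j ∘ punchIn k)}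
                                                       (≈-sym (row₀≈row₁ (punchIn j k))))))) ⟩
    sum (λ k → signP (toℕ k) (F j (punchIn j k) (punchIn j ∘ punchIn k))) ∎

laplace₀-row₁ : ∀ n (M : Matrix (suc (suc n))) → laplace₀ (M (suc zero)) M ≈ []
laplace₀-row₁ n M = begin
  laplace₀ (M (suc zero)) M         ≡⟨ sym (det-laplace₀ (suc n) M₁₁) ⟩
  det (suc (suc n)) M₁₁             ≈⟨ det-equal-rows₀₁ n M₁₁ (λ _ → ≈-refl) ⟩
  []                                ∎
  where
  M₁₁ : Matrix (suc (suc n))
  M₁₁ zero    = M (suc zero)
  M₁₁ (suc r) = M (suc r)

laplace₀-sub : ∀ {n} (u v : Vector Poly (suc n)) M → laplace₀ (λ j → u j -P v j) M ≈ laplace₀ u M -P laplace₀ v M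
laplace₀-sub {n} u v M = begin
  laplace₀ (λ j → u j -P v j) M
    ≈⟨ sum-cong-≋ (λ j → term (toℕ j) (u j) (v j) (det n (minor j M))) ⟩
  sum (λ j → signP (toℕ j) (u j *P det n (minor j M)) +P negP (signP (toℕ j) (v j *P det n (minor j M))))
    ≈⟨ ∑-distrib-+ (λ j → signP (toℕ j) (u j *P det n (minor j M)))
                     (λ j → negP (signP (toℕ j) (v j *P det n (minor j M)))) ⟩
  laplace₀ u M +P sum (λ j → negP (signP (toℕ j) (v j *P det n (minor j M))))
    ≈⟨ +-congˡ {laplace₀ u M} (sum-negP (λ j → signP (toℕ j) (v j *P det n (minor j M)))) ⟩
  laplace₀ u M -P laplace₀ v M ∎
  where
  term : ∀ k a b d → signP k ((a -P b) *P d) ≈ signP k (a *P d) +P negP (signP k (b *P d))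
  term k a b d = begin
    signP k ((a -P b) *P d)
      ≈⟨ signP-cong k (solve 3 (λ a b d → (a :- b) :* d := a :* d :+ :- (b :* d)) ≈-refl a b d) ⟩
    signP k (a *P d +P negP (b *P d))
      ≈⟨ signP-+P k (a *P d) _ ⟩
    signP k (a *P d) +P signP k (negP (b *P d))
      ≈⟨ +-congˡ {signP k (a *P d)} (signP-negP k (b *P d)) ⟩
    signP k (a *P d) +P negP (signP k (b *P d)) ∎

det-subtract-row₁ : ∀ n (M : Matrix (suc (suc n))) →
  det (suc (suc n)) M ≈ laplace₀ (λ j → M zero j -P M (suc zero) j) M
det-subtract-row₁ n M = begin
  det (suc (suc n)) M
    ≡⟨ det-laplace₀ (suc n) M ⟩
  laplace₀ (M zero) M
    ≈⟨ ≈-sym (+-identityʳ _) ⟩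
  laplace₀ (M zero) M -P []
    ≈⟨ +-congˡ {laplace₀ (M zero) M} (-‿cong (≈-sym (laplace₀-row₁ n M))) ⟩
  laplace₀ (M zero) M -P laplace₀ (M (suc zero)) M
    ≈⟨ ≈-sym (laplace₀-sub (M zero) (M (suc zero)) M) ⟩
  laplace₀ (λ j → M zero j -P M (suc zero) j) M ∎

sum-≈[] : ∀ {n} {f : Vector Poly n} → (∀ j → f j ≈ []) → sum f ≈ []
sum-≈[] {n} f≈[] = ≈-trans (sum-cong-≋ f≈[]) (sum-replicate-zero n)

signP-[] : ∀ k → signP k [] ≡ []
signP-[] zero    = refl
signP-[] (suc k) = cong negP (signP-[] k)

laplace₀-term≈[] : ∀ {n} (u : Vector Poly (suc n)) M j → u j ≈ [] → signP (toℕ j) (u j *P det n (minor j M)) ≈ []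
laplace₀-term≈[] {n} u M j uⱼ≈[] =
  ≈-trans (signP-cong (toℕ j) (*-congʳ {det n (minor j M)} uⱼ≈[])) (≡⇒≈ (signP-[] (toℕ j)))

laplace₀-support₀ : ∀ {n} (u : Vector Poly (suc n)) M → (∀ j → u (suc j) ≈ []) →
  laplace₀ u M ≈ u zero *P det n (minor zero M)
laplace₀-support₀ u M u≈[] = ≈-trans (+-congˡ {u zero *P _} (sum-≈[] λ j → laplace₀-term≈[] u M (suc j) (u≈[] j)))
                                     (+-identityʳ _)

laplace₀-support₀₁ : ∀ {n} (u : Vector Poly (suc (suc n))) M → (∀ j → u (suc (suc j)) ≈ []) →
  laplace₀ u M ≈ u zero *P det (suc n) (minor zero M) -P u (suc zero) *P det (suc n) (minor (suc zero) M)
laplace₀-support₀₁ u M u≈[] = +-congˡ {u zero *P _}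
  (≈-trans (+-congˡ {negP (u (suc zero) *P _)} (sum-≈[] λ j → laplace₀-term≈[] u M (suc (suc j)) (u≈[] j)))
           (+-identityʳ _))

-- The characteristic polynomial of a threshold graph

charMatrix : ∀ {N} → Vec Bool N → Matrix N
charMatrix b r c = (if toℕ r ≡ᵇ toℕ c then X else []) -P constP (adjMatrix b r c)

shift : Bool → Poly
shift β = X +P constP (boolℤ β)

-- Deleting row 0 and column 1 leaves the characteristic matrix of β ∷ w, except for the top-left entry.
det-minor₁ : ∀ {n} y β (w : Vec Bool n) →
  det (suc n) (minor (suc zero) (charMatrix (y ∷ᵥ β ∷ᵥ w)))
    ≈ charPolyThreshold (β ∷ᵥ w) -P shift β *P charPolyThreshold w
det-minor₁ {n} y β w = begin
  det (suc n) M₁                             ≡⟨ det-laplace₀ n M₁ ⟩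
  laplace₀ (M₁ zero) M₁                      ≈⟨ laplace₀-cong (M₁ zero) M₁ T same-rows ⟩
  laplace₀ (M₁ zero) T
    ≈⟨ solve 2 (λ a s → a := s :+ (a :- s)) ≈-refl (laplace₀ (M₁ zero) T) (laplace₀ (T zero) T) ⟩
  laplace₀ (T zero) T +P (laplace₀ (M₁ zero) T -P laplace₀ (T zero) T)
    ≈⟨ +-congˡ {laplace₀ (T zero) T} (≈-sym (laplace₀-sub (M₁ zero) (T zero) T)) ⟩
  laplace₀ (T zero) T +P laplace₀ (λ j → M₁ zero j -P T zero j) T
    ≈⟨ +-congˡ {laplace₀ (T zero) T}
         (laplace₀-support₀ (λ j → M₁ zero j -P T zero j) T (λ j → -‿inverseʳ (T zero (suc j)))) ⟩
  laplace₀ (T zero) T +P (M₁ zero zero -P T zero zero) *P charPolyThreshold w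
    ≈⟨ solve 4 (λ x b s t → s :+ ((:- b) :- (x :- con 0ℤ)) :* t := s :- (x :+ b) :* t) ≈-refl
               X (constP (boolℤ β)) (laplace₀ (T zero) T) (charPolyThreshold w) ⟩
  laplace₀ (T zero) T -P shift β *P charPolyThreshold w
    ≡⟨ cong (_-P shift β *P charPolyThreshold w) (sym (det-laplace₀ n T)) ⟩
  charPolyThreshold (β ∷ᵥ w) -P shift β *P charPolyThreshold w ∎
  where
  M₁ T : Matrix (suc n)
  M₁ = minor (suc zero) (charMatrix (y ∷ᵥ β ∷ᵥ w))
  T = charMatrix (β ∷ᵥ w)
  same-rows : ∀ r c → M₁ (suc r) c ≈ T (suc r) c
  same-rows r zero    = ≈-refl
  same-rows r (suc c) = ≈-refl

charPolyThreshold-recurrence : ∀ {n} y β (w : Vec Bool n) →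
  charPolyThreshold (y ∷ᵥ β ∷ᵥ w) ≈
    shift β *P (charPolyThreshold (β ∷ᵥ w) +P charPolyThreshold (β ∷ᵥ w) -P shift β *P charPolyThreshold w)
charPolyThreshold-recurrence {n} y β w = begin
  det (suc (suc n)) T
    ≈⟨ det-subtract-row₁ n T ⟩
  laplace₀ (λ j → T zero j -P T (suc zero) j) T
    ≈⟨ laplace₀-support₀₁ (λ j → T zero j -P T (suc zero) j) T (λ j → -‿inverseʳ (T zero (suc (suc j)))) ⟩
  d₀ *P charPolyThreshold (β ∷ᵥ w) -P d₁ *P det (suc n) (minor (suc zero) T)
    ≈⟨ +-congˡ {d₀ *P charPolyThreshold (β ∷ᵥ w)} (-‿cong (*-congˡ {d₁} (det-minor₁ y β w))) ⟩
  d₀ *P charPolyThreshold (β ∷ᵥ w) -P d₁ *P (charPolyThreshold (β ∷ᵥ w) -P shift β *P charPolyThreshold w)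
    ≈⟨ solve 4 (λ x b s t → (x :- con 0ℤ :- :- b) :* s :- (:- b :- (x :- con 0ℤ)) :* (s :- (x :+ b) :* t)
                           := (x :+ b) :* (s :+ s :- (x :+ b) :* t))
               ≈-refl X (constP (boolℤ β)) (charPolyThreshold (β ∷ᵥ w)) (charPolyThreshold w) ⟩
  shift β *P (charPolyThreshold (β ∷ᵥ w) +P charPolyThreshold (β ∷ᵥ w) -P shift β *P charPolyThreshold w) ∎
  where
  T : Matrix (suc (suc n))
  T = charMatrix (y ∷ᵥ β ∷ᵥ w)
  d₀ d₁ : Poly
  d₀ = T zero zero -P T (suc zero) zero
  d₁ = T zero (suc zero) -P T (suc zero) (suc zero)

charPolyThreshold-head : ∀ {n} y y′ (w : Vec Bool n) → charPolyThreshold (y ∷ᵥ w) ≈ charPolyThreshold (y′ ∷ᵥ w)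
charPolyThreshold-head y y′ []       = ≈-refl
charPolyThreshold-head y y′ (β ∷ᵥ w) =
  ≈-trans (charPolyThreshold-recurrence y β w) (≈-sym (charPolyThreshold-recurrence y′ β w))

-- step (x + β) maps (χ(y ∷ w), χ(w)) to (χ(y ∷ β ∷ w), χ(β ∷ w)), and a run of m + 1 bits β acts
-- as (x + β)^m times block m (x + β).
module PairMaps {c ℓ} (R : RawRing c ℓ) where
  open RawRing R renaming (_+_ to infixl 6 _⊕_; _*_ to infixl 7 _⊗_; -_ to ⊝_)

  infixl 6 _⊖_
  _⊖_ : Carrier → Carrier → Carrier
  x ⊖ y = x ⊕ ⊝ y

  step : Carrier → Carrier × Carrier → Carrier × Carrier
  step c (u , v) = c ⊗ (u ⊕ u ⊖ c ⊗ v) , u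

  scale : Carrier → Carrier × Carrier → Carrier × Carrier
  scale s (u , v) = s ⊗ u , s ⊗ v

  block : Carrier → Carrier → Carrier × Carrier → Carrier × Carrier
  block k c (u , v) = (k ⊕ 1# ⊕ 1#) ⊗ c ⊗ u ⊖ (k ⊕ 1#) ⊗ c ⊗ c ⊗ v , (k ⊕ 1#) ⊗ u ⊖ k ⊗ c ⊗ v

  -- The runs of the sequence of the theorem, read from its end, with x for X, j for i, and the
  -- powers of X + 1 and X produced by the runs abstracted as a₁, …, a₅.
  runsG : Carrier → Carrier → (a₁ a₂ a₃ a₄ a₅ : Carrier) → Carrier × Carrier
  runsG x j a₁ a₂ a₃ a₄ a₅ =
    scale a₁ (block (j ⊕ j) (x ⊕ 1#) (scale a₂ (block (j ⊖ 1#) x (scale a₃ (block (j ⊕ j ⊕ 1#) (x ⊕ 1#)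
      (scale a₄ (block (j ⊕ j) x (scale a₅ (block (j ⊕ j ⊖ 1#) (x ⊕ 1#) (x , 1#))))))))))

open PairMaps (CommutativeRing.rawRing ℤ[X]) using (step; scale; block; runsG)

-- The same maps on solver syntax, so that identities between them are checked by the ring solver
-- without writing out their expansions.
expressions : ℕ → RawRing _ _
expressions n = record
  { Carrier = Polynomial n ; _≈_ = _≡_ ; _+_ = _:+_ ; _*_ = _:*_ ; -_ = :-_
  ; 0# = con 0ℤ ; 1# = con 1ℤ }

module Syntax {n : ℕ} = PairMaps (expressions n)

ℤ[X]² : Setoid _ _
ℤ[X]² = ×-setoid setoid setoid

open Setoid ℤ[X]² using () renaming (_≈_ to _≈²_; trans to ≈²-trans)

step-block : ∀ k s c u v → step c (scale s (block k c (u , v))) ≈² scale (c *P s) (block (k +P constP 1ℤ) c (u , v))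
step-block = λ k s c u v →
  solve 5 (λ k s c u v → proj₁ (Syntax.step c (Syntax.scale s (Syntax.block k c (u , v))))
                      := proj₁ (Syntax.scale (c :* s) (Syntax.block (k :+ con 1ℤ) c (u , v)))) ≈-refl k s c u v ,
  solve 5 (λ k s c u v → proj₂ (Syntax.step c (Syntax.scale s (Syntax.block k c (u , v))))
                      := proj₂ (Syntax.scale (c :* s) (Syntax.block (k :+ con 1ℤ) c (u , v)))) ≈-refl k s c u v

step-as-block : ∀ c u v → step c (u , v) ≈² scale (constP 1ℤ) (block (constP (+ 0)) c (u , v))
step-as-block = λ c u v →
  solve 3 (λ c u v → proj₁ (Syntax.step c (u , v)) := proj₁ (Syntax.scale (con 1ℤ) (Syntax.block (con (+ 0)) c (u , v))))
    ≈-refl c u v ,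
  solve 3 (λ c u v → proj₂ (Syntax.step c (u , v)) := proj₂ (Syntax.scale (con 1ℤ) (Syntax.block (con (+ 0)) c (u , v))))
    ≈-refl c u v

step-cong : ∀ c {p q} → p ≈² q → step c p ≈² step c q
step-cong c (u≈u′ , v≈v′) = *-congˡ {c} (+-cong (+-cong u≈u′ u≈u′) (-‿cong (*-congˡ {c} v≈v′))) , u≈u′

scale-block-cong : ∀ s {k k′} c {p p′} → k ≈ k′ → p ≈² p′ →
  scale s (block k c p) ≈² scale s (block k′ c p′)
scale-block-cong s c k≈k′ (u≈u′ , v≈v′) =
  *-congˡ {s} (+-cong (*-cong (*-congʳ {c} (+-cong (+-cong k≈k′ ≈-refl) ≈-refl)) u≈u′)
                      (-‿cong (*-cong (*-congʳ {c} (*-congʳ {c} (+-cong k≈k′ ≈-refl))) v≈v′))) ,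
  *-congˡ {s} (+-cong (*-cong (+-cong k≈k′ ≈-refl) u≈u′) (-‿cong (*-cong (*-congʳ {c} k≈k′) v≈v′)))

charPair : ∀ {n} → Bool → Vec Bool n → Poly × Poly
charPair y w = charPolyThreshold (y ∷ᵥ w) , charPolyThreshold w

charPair-∷ : ∀ {n} y β (w : Vec Bool n) → charPair y (β ∷ᵥ w) ≈² step (shift β) (charPair y w)
charPair-∷ y β w = ≈²-trans (charPolyThreshold-recurrence y β w , ≈-refl) (step-cong (shift β) (head , ≈-refl))
  where head = charPolyThreshold-head β y w

constP-suc : ∀ m → constP (+ m) +P constP 1ℤ ≈ constP (+ suc m)
constP-suc m = ∷-cong (cong +_ (Data.Nat.Properties.+-comm m 1)) ≈-refl

charPair-∷-block : ∀ {n} m y β (v : Vec Bool n) p →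
  charPair y v ≈² scale (shift β ^P m) (block (constP (+ m)) (shift β) p) →
  charPair y (β ∷ᵥ v) ≈² scale (shift β ^P suc m) (block (constP (+ suc m)) (shift β) p)
charPair-∷-block m y β v p hyp =
  ≈²-trans (charPair-∷ y β v) (≈²-trans (step-cong c hyp)
    (≈²-trans (step-block (constP (+ m)) (c ^P m) c (proj₁ p) (proj₂ p))
      (scale-block-cong (c ^P suc m) c (constP-suc m) (≈-refl {proj₁ p} , ≈-refl {proj₂ p}))))
  where c = shift β

charPair-run : ∀ {n} m y β (w : Vec Bool n) →
  charPair y (replicate (suc m) β ++ w) ≈² scale (shift β ^P m) (block (constP (+ m)) (shift β) (charPair y w))
charPair-run zero    y β w =
  ≈²-trans (charPair-∷ y β w) (step-as-block (shift β) (charPolyThreshold (y ∷ᵥ w)) (charPolyThreshold w))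
charPair-run (suc m) y β w =
  charPair-∷-block m y β (replicate (suc m) β ++ w) (charPair y w) (charPair-run m y β w)

charPair-run-end : ∀ m y β →
  charPair y (replicate (suc m) β) ≈² scale (shift β ^P m) (block (constP (+ m)) (shift β) (charPair y []))
charPair-run-end zero    y β =
  ≈²-trans (charPair-∷ y β []) (step-as-block (shift β) (charPolyThreshold (y ∷ᵥ [])) (constP 1ℤ))
charPair-run-end (suc m) y β =
  charPair-∷-block m y β (replicate (suc m) β) (charPair y []) (charPair-run-end m y β)

charPair-run≈ : ∀ {n} L m y β (w : Vec Bool n) k p → L ≡ suc m → constP (+ m) ≈ k → charPair y w ≈² p →
  charPair y (replicate L β ++ w) ≈² scale (shift β ^P m) (block k (shift β) p)
charPair-run≈ L m y β w k p refl k≈ w≈ =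
  ≈²-trans (charPair-run m y β w) (scale-block-cong (shift β ^P m) (shift β) k≈ w≈)

charPair-run-end≈ : ∀ L m y β k p → L ≡ suc m → constP (+ m) ≈ k → charPair y [] ≈² p →
  charPair y (replicate L β) ≈² scale (shift β ^P m) (block k (shift β) p)
charPair-run-end≈ L m y β k p refl k≈ []≈ =
  ≈²-trans (charPair-run-end m y β) (scale-block-cong (shift β ^P m) (shift β) k≈ []≈)

-- The graph G

double : ∀ n → 2 ℕ.* n ≡ n ℕ.+ n
double = solve-∀

module RunsOfG (k : ℕ) where
  i : ℕ
  i = suc k

  J c₁ a₁ a₂ a₃ a₄ a₅ : Poly
  J  = constP (+ i)
  c₁ = X +P constP 1ℤ
  a₁ = c₁ ^P (i ℕ.+ i)
  a₂ = X ^P k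
  a₃ = c₁ ^P (i ℕ.+ i ℕ.+ 1)
  a₄ = X ^P (i ℕ.+ i)
  a₅ = c₁ ^P (k ℕ.+ i)

  -- The ≈-refl arguments hold by computation: constP (+ m) reduces to J + J, J − 1, …, and χ(0) to X.
  charPair-seqG : charPair false (tail (seqG i)) ≈² runsG X J a₁ a₂ a₃ a₄ a₅
  charPair-seqG =
    charPair-run≈ (suc (2 ℕ.* i)) (i ℕ.+ i) false true W₂ (J +P J) P₂ (cong suc (double i)) ≈-refl (
    charPair-run≈ i k false false W₃ (J -P constP 1ℤ) P₃ refl ≈-refl (
    charPair-run≈ (2 ℕ.* i ℕ.+ 2) (i ℕ.+ i ℕ.+ 1) false true W₄ (J +P J +P constP 1ℤ) P₄ (double+2 i) ≈-refl (
    charPair-run≈ (suc (2 ℕ.* i)) (i ℕ.+ i) false false W₅ (J +P J) P₅ (cong suc (double i)) ≈-refl (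
    charPair-run-end≈ (2 ℕ.* i) (k ℕ.+ i) false true (J +P J -P constP 1ℤ) (X , constP 1ℤ) (double-suc k) ≈-refl
      (≈-refl , ≈-refl)))))
    where
    double+2 : ∀ n → 2 ℕ.* n ℕ.+ 2 ≡ suc (n ℕ.+ n ℕ.+ 1)
    double+2 = solve-∀
    double-suc : ∀ n → 2 ℕ.* suc n ≡ suc (n ℕ.+ suc n)
    double-suc = solve-∀
    W₅ = replicate (2 ℕ.* i) true
    W₄ = replicate (suc (2 ℕ.* i)) false ++ W₅
    W₃ = replicate (2 ℕ.* i ℕ.+ 2) true ++ W₄
    W₂ = replicate i false ++ W₃
    P₂ P₃ P₄ P₅ : Poly × Poly
    P₅ = scale a₅ (block (J +P J -P constP 1ℤ) c₁ (X , constP 1ℤ))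
    P₄ = scale a₄ (block (J +P J) X P₅)
    P₃ = scale a₃ (block (J +P J +P constP 1ℤ) c₁ P₄)
    P₂ = scale a₂ (block (J -P constP 1ℤ) X P₃)

  powers-of-X : X ^P (3 ℕ.* i ℕ.∸ 1) ≈ a₂ *P a₄
  powers-of-X = ≈-trans (≡⇒≈ (cong (λ n → X ^P (k ℕ.+ n)) (double i))) (^P-+ X k (i ℕ.+ i))

  powers-of-X+1 : c₁ ^P (6 ℕ.* i ℕ.+ 1) ≈ a₁ *P (a₃ *P (a₅ *P c₁ ^P 1))
  powers-of-X+1 = ≈-trans (≡⇒≈ (cong (c₁ ^P_) (6i+1 k))) (≈-trans (^P-+ c₁ (i ℕ.+ i) _)
    (*-congˡ {a₁} (≈-trans (^P-+ c₁ (i ℕ.+ i ℕ.+ 1) _) (*-congˡ {a₃} (^P-+ c₁ (k ℕ.+ i) 1)))))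
    where
    6i+1 : ∀ k → 6 ℕ.* suc k ℕ.+ 1 ≡ suc k ℕ.+ suc k ℕ.+ (suc k ℕ.+ suc k ℕ.+ 1 ℕ.+ (k ℕ.+ suc k ℕ.+ 1))
    6i+1 = solve-∀

  constP-coefficient : (e : Polynomial 1 → Polynomial 1) →
    constP (⟦ e (var zero) ⟧ℤ (+ i ∷ᵥ [])) ≈ ⟦ e (var zero) ⟧ (J ∷ᵥ [])
  constP-coefficient e = constP-⟦⟧ (e (var zero)) (+ i ∷ᵥ [])

coeff₀ coeff₁ coeff₂ coeff₃ coeff₄ : ∀ {n} → Polynomial n → Polynomial n
coeff₀ j = con (+ 2) :* j :+ con (+ 1)
coeff₁ j = con (+ 8) :* j :+ con (+ 2)
coeff₂ j = :- con (+ 8) :* j :* j :+ con (+ 4) :* j :+ con (+ 3)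
coeff₃ j = :- con (+ 8) :* j :* j :* j :- con (+ 20) :* j :* j :- con (+ 8) :* j
coeff₄ j = con (+ 8) :* j :* j :* j :* j :+ con (+ 12) :* j :* j :* j :+ con (+ 4) :* j :* j

linearₑ quarticₑ : ∀ {n} → Polynomial n → Polynomial n → Polynomial n
linearₑ  x j = x :+ coeff₀ j
quarticₑ x j = x :^ 4 :- coeff₁ j :* x :^ 3 :- coeff₂ j :* x :^ 2 :- coeff₃ j :* x :- coeff₄ j

runsG-factorisation : ∀ x j a₁ a₂ a₃ a₄ a₅ →
  proj₁ (runsG x j a₁ a₂ a₃ a₄ a₅) ≈
    a₂ *P a₄ *P (a₁ *P (a₃ *P (a₅ *P (x +P constP 1ℤ) ^P 1)))
      *P ⟦ linearₑ (var zero) (var (suc zero)) ⟧ (x ∷ᵥ j ∷ᵥ [])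
      *P ⟦ quarticₑ (var zero) (var (suc zero)) ⟧ (x ∷ᵥ j ∷ᵥ [])
runsG-factorisation = solve 7 (λ x j a₁ a₂ a₃ a₄ a₅ →
  proj₁ (Syntax.runsG x j a₁ a₂ a₃ a₄ a₅)
    := a₂ :* a₄ :* (a₁ :* (a₃ :* (a₅ :* (x :+ con 1ℤ) :^ 1))) :* linearₑ x j :* quarticₑ x j) ≈-refl

lemma4 : (i : ℕ) → 1 ≤ i →
    let j : ℤ
        j = + i
        rhs : Poly
        rhs = (X ^P (3 Data.Nat.* i Data.Nat.∸ 1))
              *P ((X +P constP (+ 1)) ^P (6 Data.Nat.* i Data.Nat.+ 1))
              *P (X +P constP (+ 2 * j + + 1))
              *P ((X ^P 4)
                  -P constP (+ 8 * j + + 2) *P (X ^P 3)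
                  -P constP (- (+ 8) * j * j + + 4 * j + + 3) *P (X ^P 2)
                  -P constP (- (+ 8) * j * j * j - + 20 * j * j - + 8 * j) *P X
                  -P constP (+ 8 * j * j * j * j + + 12 * j * j * j + + 4 * j * j))
    in charPolyThreshold (seqG i) ≈P rhs ⊎ charPolyThreshold (seqG i) ≈P negP rhs
lemma4 zero    ()
lemma4 (suc k) _ = inj₁ (coeff-≡ (begin
  charPolyThreshold (seqG i)
    ≈⟨ proj₁ charPair-seqG ⟩
  proj₁ (runsG X J a₁ a₂ a₃ a₄ a₅)
    ≈⟨ runsG-factorisation X J a₁ a₂ a₃ a₄ a₅ ⟩
  a₂ *P a₄ *P (a₁ *P (a₃ *P (a₅ *P c₁ ^P 1))) *P ⟦ linearₑ (var zero) (var (suc zero)) ⟧ (X ∷ᵥ J ∷ᵥ [])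
    *P ⟦ quarticₑ (var zero) (var (suc zero)) ⟧ (X ∷ᵥ J ∷ᵥ [])
    ≈⟨ ≈-sym (*-cong (*-cong (*-cong powers-of-X powers-of-X+1) (+-congˡ {X} (constP-coefficient coeff₀)))
         (+-cong (+-cong (+-cong (+-congˡ {X ^P 4} (-‿cong (*-congʳ {X ^P 3} (constP-coefficient coeff₁))))
                                 (-‿cong (*-congʳ {X ^P 2} (constP-coefficient coeff₂))))
                         (-‿cong (*-congʳ {X} (constP-coefficient coeff₃))))
                 (-‿cong (constP-coefficient coeff₄)))) ⟩
  _ ∎))
  where open RunsOfG k
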